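{- Let $H$ be a finite graph, $r,s\ge1$ integers, and $J=(A_1,\dots,A_N)$ an $(r,s)$-protocol that clears $H$. Then $J$ is monotone if and only if for every $j$ with $1\le j\le N-1$ and every $v\in Y_j^1$ we have $v\in A_{j+1}$.
   Context: Discrete-time immunization model. Fix integers $r,s\ge 1$ and a finite graph $H$. An $(r,s)$-protocol for $H$ is a finite sequence $(A_1,\dots,A_N)$ of subsets of $V(H)$ ($A_t$ is the set of vertices immunized at time-step $t$). At time-step $0$ every vertex is red. For each $t\ge 1$ every vertex lies in exactly one of $G_t^r,\dots,G_t^1$ (green), $Y_t^s,\dots,Y_t^1$ (yellow), $R_t$ (red), determined as follows: if $v\in A_t$ then $v\in G_t^r$. If $v\notin A_t$: if $v$ was red at time $t-1$ or $v\in Y_{t-1}^1$, then $v\in R_t$; if $v\in Y_{t-1}^i$ with $2\le i\le s$, then $v\in Y_t^{i-1}$; if $v\in G_{t-1}^i$ with $2\le i\le r$, then $v\in G_t^{i-1}$; if $v\in G_{t-1}^1$ and $v$ has a neighbor in $R_t$, then $v\in Y_t^s$; otherwise $v\in G_t^1$. The protocol clears $H$ if all vertices are green at time-step $N$. An $(r,s)$-protocol that clears $H$ is monotone if for every $v\in V(H)$: whenever $v\in A_j$, $v\notin R_i$ for all $i>j$. -}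

module Defs where

open import Data.Nat using (ℕ; zero; suc; _≤_; _<_)
open import Data.Bool using (Bool; true; false; _∧_; _∨_; not)
open import Data.Fin using (Fin)
open import Data.Fin.Subset using (Subset; _∈_)
open import Data.Vec using (Vec; lookup; replicate; []; _∷_)
open import Data.List using (allFin)
open import Data.Bool.ListAction using (any)
open import Data.Product using (_×_)
open import Relation.Binary.PropositionalEquality using (_≡_; _≢_)
open import Relation.Nullary using (¬_)

record Graph (n : ℕ) : Set where
  field
    adj     : Fin n → Fin n → Bool
    symm    : ∀ u v → adj u v ≡ adj v u
    irrefl  : ∀ v → adj v v ≡ false

data Colour : Set where
  green  : ℕ → Colour
  yellow : ℕ → Colour
  red    : Colour

-- an (r,s)-protocol of length N: A_1,...,A_N  (A_t = lookup As (t-1))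
Protocol : ℕ → ℕ → Set
Protocol n N = Vec (Subset n) N

-- A_t as a function of the time-step t (empty outside 1..N)
At : ∀ {n N} → Protocol n N → ℕ → Subset n
At {n} {N} As zero = replicate n false
At {n} {zero} [] (suc t) = replicate n false
At {n} {suc N} (B ∷ As) (suc zero) = B
At {n} {suc N} (B ∷ As) (suc (suc t)) = At As (suc t)

-- vertex was red or in Y^1 (hence becomes red unless immunized)
redOrY1 : Colour → Bool
redOrY1 red = true
redOrY1 (yellow 1) = true
redOrY1 _ = false

step : ∀ {n} → Graph n → ℕ → ℕ → (Fin n → Colour) → Subset n → Fin n → Colour
step {n} H r s c A v with lookup A v
... | true = green r
... | false = go (c v)
  where
  redNow : Fin n → Bool
  redNow u = not (lookup A u) ∧ redOrY1 (c u)
  go : Colour → Colour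
  go red = red
  go (yellow 0) = red   -- unreachable
  go (yellow 1) = red
  go (yellow (suc (suc i))) = yellow (suc i)
  go (green (suc (suc i))) = green (suc i)
  go (green i) with any (λ u → Graph.adj H v u ∧ redNow u) (allFin n)
  ... | true = yellow s
  ... | false = green 1

state : ∀ {n N} → Graph n → ℕ → ℕ → Protocol n N → ℕ → Fin n → Colour
state H r s As zero v = red
state H r s As (suc t) v = step H r s (state H r s As t) (At As (suc t)) v

isGreen : Colour → Set
isGreen (green _) = Data.Unit.⊤ where import Data.Unit
isGreen _ = Data.Empty.⊥ where import Data.Empty

Clears : ∀ {n N} → Graph n → ℕ → ℕ → Protocol n N → Set
Clears {n} {N} H r s As = ∀ v → isGreen (state H r s As N v)

Monotone : ∀ {n N} → Graph n → ℕ → ℕ → Protocol n N → Set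
Monotone {n} {N} H r s As =
  ∀ (v : Fin n) (j i : ℕ) → 1 ≤ j → j ≤ N → v ∈ At As j → j < i → i ≤ N →
  state H r s As i v ≢ red

Y1Immunized : ∀ {n N} → Graph n → ℕ → ℕ → Protocol n N → Set
Y1Immunized {n} {N} H r s As =
  ∀ (v : Fin n) (j : ℕ) → 1 ≤ j → suc j ≤ N →
  state H r s As j v ≡ yellow 1 → v ∈ At As (suc j)

-- A vertex leaves the green states only through Y^1 (a vertex never sits in
-- Y^0 when s ≥ 1), and from Y^1 it turns red at the next step unless it is
-- immunized then. So immunizing every Y^1-vertex on time keeps each vertex
-- non-red from its first immunization on; conversely, a Y^1-vertex at time j
-- was immunized at some time ≤ j, and leaving it out of A_{j+1} makes it red
-- after that immunization.
module Submission where

open import Defs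
open import Data.Nat using (ℕ; zero; suc; _≤_; _≤′_; ≤′-refl; ≤′-step; s≤s; z≤n)
open import Data.Nat.Properties using (≤-refl; ≤-trans; m≤n⇒m≤1+n; <⇒≤; ≤⇒≤′; ≤′⇒≤)
open import Data.Bool using (Bool; true; false; _∧_; not)
open import Data.Bool.ListAction using (any)
open import Data.List using (allFin)
open import Data.Fin using (Fin)
open import Data.Fin.Subset using (Subset; _∈_; _∉_)
open import Data.Fin.Subset.Properties using (_∈?_)
open import Data.Vec using (lookup)
open import Data.Vec.Properties using ([]=⇒lookup; lookup⇒[]=)
open import Data.Sum using (_⊎_; inj₁; inj₂)
open import Data.Product using (Σ-syntax; _×_; _,_)
open import Data.Empty using (⊥-elim)
open import Function using (case_of_)
open import Relation.Nullary using (yes; no)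
open import Relation.Binary.PropositionalEquality using (_≡_; _≢_; refl; sym; trans)

∉⇒lookup≡false : ∀ {n} {A : Subset n} {v : Fin n} → v ∉ A → lookup A v ≡ false
∉⇒lookup≡false {A = A} {v} v∉A with lookup A v in v∈?
... | true  = ⊥-elim (v∉A (lookup⇒[]= v A v∈?))
... | false = refl

lookup≡false⇒∉ : ∀ {n} {A : Subset n} {v : Fin n} → lookup A v ≡ false → v ∉ A
lookup≡false⇒∉ A[v]≡false v∈A with () ← trans (sym ([]=⇒lookup v∈A)) A[v]≡false

module _ {n : ℕ} (H : Graph n) (r s : ℕ) (c : Fin n → Colour) (A : Subset n) (v : Fin n) where

  -- The guard of the green clauses of `step`, named so that `with` can abstract it.
  hasRedNeighbour : Bool
  hasRedNeighbour = any (λ u → Graph.adj H v u ∧ (not (lookup A u) ∧ redOrY1 (c u))) (allFin n)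

  step-immunized : v ∈ A → step H r s c A v ≡ green r
  step-immunized v∈A rewrite []=⇒lookup v∈A = refl

  step-turnsRed : v ∉ A → c v ≡ red ⊎ c v ≡ yellow 1 → step H r s c A v ≡ red
  step-turnsRed v∉A (inj₁ cv≡red) rewrite ∉⇒lookup≡false v∉A | cv≡red = refl
  step-turnsRed v∉A (inj₂ cv≡y¹)  rewrite ∉⇒lookup≡false v∉A | cv≡y¹  = refl

  step-red⇒ : step H r s c A v ≡ red →
    v ∉ A × (c v ≡ red ⊎ c v ≡ yellow 1 ⊎ c v ≡ yellow 0)
  step-red⇒ with lookup A v in A[v]
  ... | true = λ ()
  ... | false with c v
  ... | red                  = λ _ → lookup≡false⇒∉ A[v] , inj₁ refl
  ... | yellow 0             = λ _ → lookup≡false⇒∉ A[v] , inj₂ (inj₂ refl)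
  ... | yellow 1             = λ _ → lookup≡false⇒∉ A[v] , inj₂ (inj₁ refl)
  ... | yellow (suc (suc _)) = λ ()
  ... | green (suc (suc _))  = λ ()
  ... | green 0 with hasRedNeighbour
  ... | true  = λ ()
  ... | false = λ ()
  step-red⇒ | false | green 1 with hasRedNeighbour
  ... | true  = λ ()
  ... | false = λ ()

  step≢yellow0 : 1 ≤ s → step H r s c A v ≢ yellow 0
  step≢yellow0 1≤s with lookup A v
  ... | true = λ ()
  ... | false with c v
  ... | red                  = λ ()
  ... | yellow 0             = λ ()
  ... | yellow 1             = λ ()
  ... | yellow (suc (suc _)) = λ ()
  ... | green (suc (suc _))  = λ ()
  ... | green 0 with hasRedNeighbour
  ... | true  = λ { refl → case 1≤s of λ () }
  ... | false = λ ()
  step≢yellow0 1≤s | false | green 1 with hasRedNeighbour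
  ... | true  = λ { refl → case 1≤s of λ () }
  ... | false = λ ()

module _ {n N : ℕ} (H : Graph n) (r s : ℕ) (As : Protocol n N) where

  private
    colour : ℕ → Fin n → Colour
    colour = state H r s As

  state≢yellow0 : 1 ≤ s → ∀ t v → colour t v ≢ yellow 0
  state≢yellow0 _   zero    v = λ ()
  state≢yellow0 1≤s (suc t) v = step≢yellow0 H r s (colour t) (At As (suc t)) v 1≤s

  nonRed⇒immunizedBefore : ∀ t v → colour t v ≢ red → Σ[ j ∈ ℕ ] 1 ≤ j × j ≤ t × v ∈ At As j
  nonRed⇒immunizedBefore zero    v notRed = ⊥-elim (notRed refl)
  nonRed⇒immunizedBefore (suc t) v notRed with v ∈? At As (suc t)
  ... | yes v∈A = suc t , s≤s z≤n , ≤-refl , v∈A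
  ... | no v∉A with nonRed⇒immunizedBefore t v
                     (λ wasRed → notRed (step-turnsRed H r s (colour t) (At As (suc t)) v v∉A (inj₁ wasRed)))
  ... | j , 1≤j , j≤t , v∈Aj = j , 1≤j , m≤n⇒m≤1+n j≤t , v∈Aj

  monotone⇒y1Immunized : Monotone H r s As → Y1Immunized H r s As
  monotone⇒y1Immunized mono v j 1≤j j<N isY¹ with v ∈? At As (suc j)
  ... | yes v∈A = v∈A
  ... | no v∉A with nonRed⇒immunizedBefore j v (λ isRed → case trans (sym isRed) isY¹ of λ ())
  ... | i , 1≤i , i≤j , v∈Ai =
    ⊥-elim (mono v i (suc j) 1≤i (≤-trans i≤j (<⇒≤ j<N)) v∈Ai (s≤s i≤j) j<N
             (step-turnsRed H r s (colour j) (At As (suc j)) v v∉A (inj₂ isY¹)))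

  y1Immunized⇒staysNonRed : 1 ≤ s → Y1Immunized H r s As →
    ∀ {v j i} → 1 ≤ j → v ∈ At As j → j ≤′ i → i ≤ N → colour i v ≢ red
  y1Immunized⇒staysNonRed _ _ {v} {suc j} _ v∈Aj ≤′-refl _ isRed
    with () ← trans (sym (step-immunized H r s (colour j) (At As (suc j)) v v∈Aj)) isRed
  y1Immunized⇒staysNonRed 1≤s y1 {v} {j} {suc i} 1≤j v∈Aj (≤′-step j≤i) i<N isRed
    with step-red⇒ H r s (colour i) (At As (suc i)) v isRed
  ... | _   , inj₁ wasRed         = y1Immunized⇒staysNonRed 1≤s y1 1≤j v∈Aj j≤i (<⇒≤ i<N) wasRed
  ... | _   , inj₂ (inj₂ wasY⁰)   = state≢yellow0 1≤s i v wasY⁰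
  ... | v∉A , inj₂ (inj₁ wasY¹) = v∉A (y1 v i (≤-trans 1≤j (≤′⇒≤ j≤i)) i<N wasY¹)

proposition3p6 : ∀ {n N : ℕ} (H : Graph n) (r s : ℕ) → 1 ≤ r → 1 ≤ s →
    (As : Protocol n N) → Clears H r s As →
    (Monotone H r s As → Y1Immunized H r s As) × (Y1Immunized H r s As → Monotone H r s As)
proposition3p6 H r s _ 1≤s As _ =
  monotone⇒y1Immunized H r s As ,
  λ y1 v j i 1≤j _ v∈Aj j<i i≤N →
    y1Immunized⇒staysNonRed H r s As 1≤s y1 1≤j v∈Aj (≤⇒≤′ (<⇒≤ j<i)) i≤N
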